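{- Let $\nu\in\mathcal{E}$ in expanded indexing, and let $i<i'$ be in $I$ such that every index $u\in\{i,i+2,\ldots,i'\}$ lies in $I$ (so $\nu_i+\nu_{i+1}\gg\nu_{i+2}+\nu_{i+3}\gg\cdots\gg\nu_{i'}+\nu_{i'+1}$ are consecutive secondary parts) and $\nu_u+\nu_{u+1}\not\triangleright\,\nu_{u+2}+\nu_{u+3}$ for every $u\in[i,i')\cap I$. Then $\nu_{i'}+\nu_{i'+1}+\frac{i'-i}{2}\succ\nu_i+\nu_{i+1}$.
   Context: Primary colors $a_1<\cdots<a_n$; secondary colors $a_ia_j$ ($i<j$); total order $a_1a_2<\cdots<a_1a_n<a_1<a_2a_3<\cdots<a_2a_n<a_2<\cdots<a_{n-1}a_n<a_{n-1}<a_n$. A part $k_p$ has integer size $k$ and color $p$; $k_p+m=(k+m)_p$. $k_p\succ l_q$ iff $k-l\ge\chi(p\le q)$; $\succeq$ means $\succ$ or equal. Special pairs: $(a_ka_l,a_ia_j)$ with $i<j<k<l$ or $k<i<j<l$. $\mathcal{P}$: primary-colored parts of positive size; $\mathcal{S}$: secondary-colored parts of size $\ge2$. $k_p\triangleright l_q$ iff $k_p\succeq(l+1)_q$ when $p$ or $q$ primary, $k_p\succ(l+1)_q$ when both secondary. $k_p\gg l_q$ iff $k_p\succeq(l+1)_q$ when $p$ or $q$ primary; $k_p\succ(l+1)_q$ when both secondary and not special; $k_p\succ l_q$ when special. $\mathcal{E}$: finite sequences $\nu_1\gg\cdots\gg\nu_t$ in $\mathcal{P}\sqcup\mathcal{S}$.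 Halves: $\alpha((2k)_{a_ia_j})=k_{a_j}$, $\beta((2k)_{a_ia_j})=k_{a_i}$, $\alpha((2k+1)_{a_ia_j})=(k+1)_{a_i}$, $\beta((2k+1)_{a_ia_j})=k_{a_j}$. Expanded indexing: for $\nu$ with $p$ primary and $s$ secondary parts, $\nu=(\nu_1,\ldots,\nu_{p+2s})$ replacing each secondary part in place by its upper half then lower half; $I$ = indices of upper halves; for $i\in I$, $\nu_i+\nu_{i+1}$ denotes the original secondary part. -}

module Defs where

open import Data.Nat as ℕ using (ℕ; zero; suc; _<ᵇ_; _≡ᵇ_; _≤ᵇ_)
open import Data.Integer as ℤ using (ℤ; +_)
open import Data.Fin using (Fin; toℕ)
open import Data.Bool using (Bool; true; false; _∨_; _∧_; if_then_else_)
open import Data.Product using (_×_)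
open import Data.Sum using (_⊎_)
open import Relation.Nullary using (¬_)
open import Data.Empty using (⊥)
open import Data.Unit using (⊤)
open import Relation.Binary.PropositionalEquality using (_≡_)

-- Colors for n primary colors a_0 < ... < a_{n-1} (0-based).
data Color (n : ℕ) : Set where
  prim : Fin n → Color n
  sec  : (i j : Fin n) → toℕ i ℕ.< toℕ j → Color n

-- Sort key realising the total order
-- a1a2 < ... < a1an < a1 < a2a3 < ... < a2an < a2 < ... < a_n :
-- a_i a_j ↦ (i , j),  a_i ↦ (i , n)  (lexicographic).
key₁ : ∀ {n} → Color n → ℕ
key₁ (prim i)    = toℕ i
key₁ (sec i j _) = toℕ i

key₂ : ∀ {n} → Color n → ℕ
key₂ {n} (prim i) = n
key₂ (sec i j _)  = toℕ j

_≤ᶜ_ : ∀ {n} → Color n → Color n → Bool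
p ≤ᶜ q = (key₁ p <ᵇ key₁ q) ∨ ((key₁ p ≡ᵇ key₁ q) ∧ (key₂ p ≤ᵇ key₂ q))

χ≤ : ∀ {n} → Color n → Color n → ℤ
χ≤ p q = if p ≤ᶜ q then + 1 else + 0

record Part (n : ℕ) : Set where
  constructor _﹫_
  field
    size  : ℤ
    color : Color n
open Part public

_+ₚ_ : ∀ {n} → Part n → ℤ → Part n
(k ﹫ p) +ₚ m = (k ℤ.+ m) ﹫ p

_≻_ : ∀ {n} → Part n → Part n → Set
(k ﹫ p) ≻ (l ﹫ q) = χ≤ p q ℤ.≤ (k ℤ.- l)

_≽_ : ∀ {n} → Part n → Part n → Set
x ≽ y = x ≻ y ⊎ x ≡ y

Special : ∀ {n} → Color n → Color n → Set
Special (sec k l _) (sec i j _) =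
  (toℕ j ℕ.< toℕ k) ⊎ (toℕ k ℕ.< toℕ i × toℕ j ℕ.< toℕ l)
Special _ _ = ⊥

InPS : ∀ {n} → Part n → Set
InPS (k ﹫ prim _)    = + 1 ℤ.≤ k
InPS (k ﹫ sec _ _ _) = + 2 ℤ.≤ k

IsSecondary : ∀ {n} → Part n → Set
IsSecondary (k ﹫ prim _) = ⊥
IsSecondary (k ﹫ sec _ _ _) = ⊤

_▷_ : ∀ {n} → Part n → Part n → Set
x@(_ ﹫ prim _)    ▷ y                  = x ≽ (y +ₚ (+ 1))
x@(_ ﹫ sec _ _ _) ▷ y@(_ ﹫ prim _)    = x ≽ (y +ₚ (+ 1))
x@(_ ﹫ sec _ _ _) ▷ y@(_ ﹫ sec _ _ _) = x ≻ (y +ₚ (+ 1))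

_≫_ : ∀ {n} → Part n → Part n → Set
x@(_ ﹫ prim _)    ≫ y                  = x ≽ (y +ₚ (+ 1))
x@(_ ﹫ sec _ _ _) ≫ y@(_ ﹫ prim _)    = x ≽ (y +ₚ (+ 1))
x@(_ ﹫ p@(sec _ _ _)) ≫ y@(_ ﹫ q@(sec _ _ _)) =
  (¬ Special p q × x ≻ (y +ₚ (+ 1))) ⊎ (Special p q × x ≻ y)

-- ν = (ν 0, …, ν (t-1)) ∈ ℰ  (values of ν at indices ≥ t are irrelevant)
InE : ∀ {n} → (t : ℕ) → (ℕ → Part n) → Set
InE t ν = (∀ k → k ℕ.< t → InPS (ν k))
        × (∀ k → suc k ℕ.< t → ν k ≫ ν (suc k))

module Submission where

-- Two consecutive secondary parts x ≫ y with x ⋫ y must form a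
-- special pair (otherwise x ≫ y already says x ▷ y), and failing
-- x ≻ y + 1 then bounds the size drop from x to y:
--   * if x = k_{a_a a_b}, y = l_{a_c a_d} with d < a, then y's color precedes x's
--     and the drop k - l is ≤ 0;
--   * if instead a < c < d < b, the drop is ≤ 1 but the first color index grows.
-- In both cases y + 1 lies "above" x in the sense of the relation x ⊏ y below:
-- the size gap is ≥ 1, or it is ≥ 0 and the first color index strictly grows.
-- This relation is transitive and invariant under shifting both sizes, so along
-- a run of m+1 stalled steps it telescopes to ν_i ⊏ ν_{i+m+1} + (m+1); finally
-- x ⊏ y implies y ≻ x, because a larger first color index forces χ(y ≤ x) = 0.
-- The file proves: facts about χ, the relation ⊏ and its properties, the
-- stalled-step lemma, the telescoping lemma, and then the theorem.
-- (Parts are indexed consecutively here, so the shift (i'-i)/2 of the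
-- expanded indexing becomes i' ∸ i.)

open import Defs
open import Data.Nat using (ℕ; _<_; _≤_; _∸_; suc)
open import Data.Integer using (+_)
open import Relation.Nullary using (¬_)

open import Data.Nat as ℕ using (zero; _<ᵇ_; _≡ᵇ_; _≤ᵇ_; s≤s; z≤n)
import Data.Nat.Properties as ℕP
open import Data.Integer as ℤ using (ℤ; _-_)
import Data.Integer.Properties as ℤP
open import Data.Integer.Tactic.RingSolver using (solve-∀)
open import Data.Bool using (Bool; true; false; _∨_; _∧_)
open import Data.Product using (∃-syntax; _,_)
open import Data.Sum using (_⊎_; inj₁; inj₂)
open import Data.Empty using (⊥-elim)
open import Relation.Binary.PropositionalEquality

lex-test-false : ∀ a b (c : Bool) → b < a → ((a <ᵇ b) ∨ ((a ≡ᵇ b) ∧ c)) ≡ false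
lex-test-false (suc a) zero    c _       = refl
lex-test-false (suc a) (suc b) c (s≤s h) = lex-test-false a b c h

χ≤-key : ∀ {n} (p q : Color n) → key₁ q < key₁ p → χ≤ p q ≡ + 0
χ≤-key p q h rewrite lex-test-false (key₁ p) (key₁ q) (key₂ p ≤ᵇ key₂ q) h = refl

χ≤-≤1 : ∀ {n} (p q : Color n) → χ≤ p q ℤ.≤ + 1
χ≤-≤1 p q with p ≤ᶜ q
... | true  = ℤP.≤-refl
... | false = ℤ.+≤+ z≤n

gap : ∀ {n} → Part n → Part n → ℤ
gap x y = size y - size x

infix 4 _⊏_
data _⊏_ {n} (x y : Part n) : Set where
  gap-pos : + 1 ℤ.≤ gap x y → x ⊏ y
  gap-key : + 0 ℤ.≤ gap x y → key₁ (color x) < key₁ (color y) → x ⊏ y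

⊏⇒0≤gap : ∀ {n} {x y : Part n} → x ⊏ y → + 0 ℤ.≤ gap x y
⊏⇒0≤gap (gap-pos 1≤g)   = ℤP.≤-trans (ℤ.+≤+ z≤n) 1≤g
⊏⇒0≤gap (gap-key 0≤g _) = 0≤g

gap-add : ∀ {n} {c d : ℤ} (x y z : Part n) →
  c ℤ.≤ gap x y → d ℤ.≤ gap y z → c ℤ.+ d ℤ.≤ gap x z
gap-add {c = c} {d} x y z c≤ d≤ = subst (c ℤ.+ d ℤ.≤_) (split (size x) (size y) (size z)) (ℤP.+-mono-≤ c≤ d≤)
  where
  split : ∀ a b e → (b - a) ℤ.+ (e - b) ≡ e - a
  split = solve-∀

⊏-trans : ∀ {n} {x y z : Part n} → x ⊏ y → y ⊏ z → x ⊏ z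
⊏-trans {x = x} {y} {z} (gap-pos 1≤g) y⊏z = gap-pos (gap-add x y z 1≤g (⊏⇒0≤gap y⊏z))
⊏-trans {x = x} {y} {z} (gap-key 0≤g _) (gap-pos 1≤g') = gap-pos (gap-add x y z 0≤g 1≤g')
⊏-trans {x = x} {y} {z} (gap-key 0≤g k<k') (gap-key 0≤g' k'<k'') =
  gap-key (gap-add x y z 0≤g 0≤g') (ℕP.<-trans k<k' k'<k'')

gap-shift : ∀ {n} (a : ℤ) (x y : Part n) → gap (x +ₚ a) (y +ₚ a) ≡ gap x y
gap-shift a (k ﹫ _) (l ﹫ _) = cancel k l a
  where
  cancel : ∀ k l a → (l ℤ.+ a) - (k ℤ.+ a) ≡ l - k
  cancel = solve-∀

⊏-shift : ∀ {n} (a : ℤ) {x y : Part n} → x ⊏ y → x +ₚ a ⊏ y +ₚ a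
⊏-shift a {x} {y} (gap-pos 1≤g) = gap-pos (subst (+ 1 ℤ.≤_) (sym (gap-shift a x y)) 1≤g)
⊏-shift a {k ﹫ p} {l ﹫ q} (gap-key 0≤g p<q) =
  gap-key (subst (+ 0 ℤ.≤_) (sym (gap-shift a (k ﹫ p) (l ﹫ q))) 0≤g) p<q

+ₚ-+ₚ : ∀ {n} (x : Part n) (a b : ℤ) → (x +ₚ a) +ₚ b ≡ x +ₚ (a ℤ.+ b)
+ₚ-+ₚ (k ﹫ p) a b = cong (_﹫ p) (ℤP.+-assoc k a b)

-- Lying above implies dominance: a positive gap beats χ ≤ 1, and a larger
-- first color index makes χ(y ≤ x) = 0.
⊏⇒≻ : ∀ {n} {x y : Part n} → x ⊏ y → y ≻ x
⊏⇒≻ {x = k ﹫ p} {l ﹫ q} (gap-pos 1≤g)     = ℤP.≤-trans (χ≤-≤1 q p) 1≤g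
⊏⇒≻ {x = k ﹫ p} {l ﹫ q} (gap-key 0≤g p<q) = subst (ℤ._≤ l - k) (sym (χ≤-key q p p<q)) 0≤g

failed-gap : ∀ (c k m : ℤ) → ¬ (c ℤ.≤ k - m) → + 1 - c ℤ.≤ m - k
failed-gap c k m c≰ = subst (+ 1 - c ℤ.≤_) (flip k m)
  (ℤP.+-monoʳ-≤ (+ 1) (ℤP.neg-mono-≤ (ℤP.i<j⇒suc[i]≤j (ℤP.≰⇒> c≰))))
  where
  flip : ∀ k m → + 1 - (+ 1 ℤ.+ (k - m)) ≡ m - k
  flip = solve-∀

-- The key step: consecutive secondary parts x ≫ y with x ⋫ y satisfy x ⊏ y + 1.
-- The pair must be special; the two kinds of special pair give the two
-- alternatives of ⊏.
stalled-step : ∀ {n} (x y : Part n) → IsSecondary x → IsSecondary y →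
  x ≫ y → ¬ (x ▷ y) → x ⊏ (y +ₚ (+ 1))
stalled-step (k ﹫ prim _) y () _ _ _
stalled-step (k ﹫ sec _ _ _) (l ﹫ prim _) _ () _ _
stalled-step (k ﹫ sec _ _ _) (l ﹫ sec _ _ _) _ _ (inj₁ (_ , x▷y)) x⋫y = ⊥-elim (x⋫y x▷y)
stalled-step (k ﹫ p@(sec a b _)) (l ﹫ q@(sec c d c<d)) _ _ (inj₂ (inj₁ d<a , _)) x⋫y =
  gap-pos (subst (λ χ → + 1 - χ ℤ.≤ (l ℤ.+ + 1) - k) (χ≤-key p q (ℕP.<-trans c<d d<a))
              (failed-gap (χ≤ p q) k (l ℤ.+ + 1) x⋫y))
stalled-step (k ﹫ p@(sec a b _)) (l ﹫ q@(sec c d _)) _ _ (inj₂ (inj₂ (a<c , _) , _)) x⋫y =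
  gap-key (ℤP.≤-trans (ℤP.i≤j⇒0≤j-i (χ≤-≤1 p q)) (failed-gap (χ≤ p q) k (l ℤ.+ + 1) x⋫y)) a<c

telescope : ∀ {n} (f : ℕ → Part n) (m : ℕ) →
  (∀ k → k ≤ m → f k ⊏ (f (suc k) +ₚ (+ 1))) →
  f 0 ⊏ (f (suc m) +ₚ (+ suc m))
telescope f zero    steps = steps 0 z≤n
telescope f (suc m) steps = ⊏-trans (telescope f m (λ k k≤m → steps k (ℕP.m≤n⇒m≤1+n k≤m)))
  (subst (f (suc m) +ₚ (+ suc m) ⊏_) (+ₚ-+ₚ (f (suc (suc m))) (+ 1) (+ suc m))
         (⊏-shift (+ suc m) (steps (suc m) ℕP.≤-refl)))

above : ∀ {i i' : ℕ} → i < i' → ∃[ m ] suc m ℕ.+ i ≡ i'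
above {i} i<i' with m , eq ← ℕP.m≤n⇒∃[o]m+o≡n i<i' = m , trans (cong suc (ℕP.+-comm m i)) eq

-- Writing i' = i + (m+1), the m+1 stalled steps between ν i and ν i' telescope.
lemma5p2 : ∀ {n : ℕ} (t : ℕ) (ν : ℕ → Part n) → InE t ν →
    ∀ (i i' : ℕ) → i < i' → i' < t →
    (∀ u → i ≤ u → u ≤ i' → IsSecondary (ν u)) →
    (∀ u → i ≤ u → u < i' → ¬ (ν u ▷ ν (suc u))) →
    (ν i' +ₚ (+ (i' ∸ i))) ≻ ν i
lemma5p2 t ν (_ , ≫-chain) i i' i<i' i'<t secondary not▷ with m , refl ← above i<i'
  rewrite ℕP.m+n∸n≡m (suc m) i = ⊏⇒≻ (telescope (λ k → ν (k ℕ.+ i)) m step)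
  where
  step : ∀ k → k ≤ m → ν (k ℕ.+ i) ⊏ (ν (suc k ℕ.+ i) +ₚ (+ 1))
  step k k≤m = stalled-step (ν (k ℕ.+ i)) (ν (suc k ℕ.+ i))
      (secondary (k ℕ.+ i) (ℕP.m≤n+m i k) (ℕP.m≤n⇒m≤1+n k+i≤m+i))
      (secondary (suc k ℕ.+ i) (ℕP.m≤n+m i (suc k)) (s≤s k+i≤m+i))
      (≫-chain (k ℕ.+ i) (ℕP.≤-<-trans (s≤s k+i≤m+i) i'<t))
      (not▷ (k ℕ.+ i) (ℕP.m≤n+m i k) (s≤s k+i≤m+i))
    where
    k+i≤m+i : k ℕ.+ i ≤ m ℕ.+ i
    k+i≤m+i = ℕP.+-monoˡ-≤ i k≤m
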